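{- Let $k\ge 3$, let $\mathcal{G}=(V,\mathcal{F})$ be an $S(k-2,k-1,n)$ Steiner system, and let $\mathcal{H}=(V,\mathcal{E})$ be a $k$-uniform hypergraph which is a chain-connected extension of $\mathcal{G}$ and does not contain mutually extended edges. Then $\mathcal{H}$ is a $k$-uniform 2-hypertree.
   Context: An $S(k-2,k-1,n)$ Steiner system is a $(k-1)$-uniform hypergraph $(V,\mathcal{F})$ with $|V|=n$ in which every $(k-2)$-subset of $V$ is contained in exactly one edge. For a $k$-uniform hypergraph $\mathcal{H}=(V,\mathcal{E})$ and a $(k-1)$-uniform hypergraph $\mathcal{G}=(V,\mathcal{F})$ on the same vertex set, $\mathcal{H}$ is an extension of $\mathcal{G}$ if every edge of $\mathcal{H}$ contains an edge of $\mathcal{G}$. Two edges $f_1,f_2\in\mathcal{F}$ are mutually extended (in $\mathcal{H}$) if $|f_1\cap f_2|=k-3$ and there exist $v_1\in f_1$, $v_2\in f_2$ with $f_1\cup\{v_2\}\in\mathcal{E}$ and $f_2\cup\{v_1\}\in\mathcal{E}$. A $k$-uniform hypergraph (finite vertex set, edges are $k$-subsets, no multiple edges) is a chain if there is a sequence $v_1,\dots,v_l$ of its vertices in which every vertex appears at least once (possibly more times), $v_1\ne v_l$, and its edge set consists of exactly the $l-k+1$ distinct sets $\{v_i,\dots,v_{i+k-1}\}$, $1\le i\le l-k+1$; it is a semicycle if the same holds with $v_1=v_l$ instead. Length = number of edges. Chain-connected: every pair of distinct vertices is contained in some subhypergraph that is a chain; semicycle-free: no subhypergraph is a semicycle. A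 hypertree is a chain-connected, semicycle-free $k$-uniform hypergraph; a 2-hypertree is a hypertree in which every chain (subhypergraph) has length at most 2. -}

module Defs where

open import Data.Nat using (ℕ; zero; suc; _≤_; _≤?_; _∸_)
open import Data.Fin using (Fin)
open import Data.Fin.Subset using (Subset; ⁅_⁆; _∪_; _∩_; _⊆_; ∣_∣; ⊥) renaming (_∈_ to _∈ₛ_)
open import Data.List using (List; []; _∷_; _++_; [_]; take; length)
open import Data.List.Membership.Propositional using () renaming (_∈_ to _∈ₗ_)
open import Data.List.Relation.Unary.All using (All)
open import Data.List.Relation.Unary.AllPairs using (AllPairs)
open import Data.Product using (Σ; ∃; _×_; ∃-syntax)
open import Relation.Binary.PropositionalEquality using (_≡_; _≢_)
open import Relation.Nullary using (¬_; yes; no)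

Hypergraph : ℕ → Set₁
Hypergraph n = Subset n → Set

Uniform : {n : ℕ} → ℕ → Hypergraph n → Set
Uniform r E = ∀ e → E e → ∣ e ∣ ≡ r

listSet : {n : ℕ} → List (Fin n) → Subset n
listSet []       = ⊥
listSet (x ∷ xs) = ⁅ x ⁆ ∪ listSet xs

-- consecutive windows {v_i, ..., v_{i+k-1}} (1 ≤ i ≤ l-k+1) of a sequence v_1 ... v_l
windows : {A : Set} → ℕ → List A → List (List A)
windows k []       = []
windows k (x ∷ xs) with k ≤? length (x ∷ xs)
... | yes _ = take k (x ∷ xs) ∷ windows k xs
... | no  _ = []

-- the edge sets of the (semi)cycle/chain determined by a sequence
windowSets : {n : ℕ} → ℕ → List (Fin n) → List (Subset n)
windowSets k xs = Data.List.map listSet (windows k xs)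
  where import Data.List

-- The sequence determines a k-uniform subhypergraph of H: it has at least one edge
-- (l ≥ k), every window is a k-set which is an edge of H, and the windows are
-- pairwise distinct (so there are exactly l-k+1 edges).
SeqSub : {n : ℕ} → ℕ → Hypergraph n → List (Fin n) → Set
SeqSub k E xs =
  (k ≤ length xs) ×
  All (λ w → (∣ w ∣ ≡ k) × E w) (windowSets k xs) ×
  AllPairs _≢_ (windowSets k xs)

IsChainIn : {n : ℕ} → ℕ → Hypergraph n → List (Fin n) → Set
IsChainIn k E xs =
  SeqSub k E xs ×
  ∃[ a ] ∃[ b ] ∃[ mid ] ((xs ≡ a ∷ mid ++ [ b ]) × a ≢ b)

IsSemicycleIn : {n : ℕ} → ℕ → Hypergraph n → List (Fin n) → Set
IsSemicycleIn k E xs =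
  SeqSub k E xs ×
  ∃[ a ] ∃[ mid ] (xs ≡ a ∷ mid ++ [ a ])

-- length of the chain = number of edges = l - k + 1
chainLength : {n : ℕ} → ℕ → List (Fin n) → ℕ
chainLength k xs = length (windows k xs)

ChainConnected : {n : ℕ} → ℕ → Hypergraph n → Set
ChainConnected k E =
  ∀ u v → u ≢ v → ∃[ xs ] (IsChainIn k E xs × u ∈ₗ xs × v ∈ₗ xs)

SemicycleFree : {n : ℕ} → ℕ → Hypergraph n → Set
SemicycleFree k E = ∀ xs → ¬ IsSemicycleIn k E xs

IsHypertree : {n : ℕ} → ℕ → Hypergraph n → Set
IsHypertree k E = Uniform k E × ChainConnected k E × SemicycleFree k E

Is2Hypertree : {n : ℕ} → ℕ → Hypergraph n → Set
Is2Hypertree k E =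
  IsHypertree k E × (∀ xs → IsChainIn k E xs → chainLength k xs ≤ 2)

IsSteiner : {n : ℕ} → ℕ → Hypergraph n → Set
IsSteiner k F =
  Uniform (k ∸ 1) F ×
  (∀ S → ∣ S ∣ ≡ k ∸ 2 →
     (∃[ f ] (F f × S ⊆ f)) ×
     (∀ f g → F f → F g → S ⊆ f → S ⊆ g → f ≡ g))

IsExtension : {n : ℕ} → Hypergraph n → Hypergraph n → Set
IsExtension E F = ∀ e → E e → ∃[ f ] (F f × f ⊆ e)

MutuallyExtended : {n : ℕ} → ℕ → Hypergraph n → Subset n → Subset n → Set
MutuallyExtended k E f₁ f₂ =
  (∣ f₁ ∩ f₂ ∣ ≡ k ∸ 3) ×
  ∃[ v₁ ] ∃[ v₂ ] ((v₁ ∈ₛ f₁) × (v₂ ∈ₛ f₂) × E (f₁ ∪ ⁅ v₂ ⁆) × E (f₂ ∪ ⁅ v₁ ⁆))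

NoMutuallyExtended : {n : ℕ} → ℕ → Hypergraph n → Hypergraph n → Set
NoMutuallyExtended k E F = ∀ f₁ f₂ → F f₁ → F f₂ → ¬ MutuallyExtended k E f₁ f₂

module Submission where

-- Write k = j + 3.  The heart of the proof is a statement about two distinct edges
-- e₁ = P ∪ {a} and e₂ = P ∪ {b} of H that share a (k-1)-set P: the edge f of G
-- inside e₂ must be P itself.  Otherwise f = e₂ - x₂ with x₂ ∈ P, and the edge
-- f₁ = e₁ - x₁ of G inside e₁ either shares the (k-2)-set P - x₂ with f (so f₁ = f
-- by the Steiner property, which is impossible as b ∈ f) or x₁ ∈ P - x₂, and then
-- f₁ and f are mutually extended.  Only uniqueness of the G-edge through a
-- (k-2)-set is used, so we work with that weaker hypothesis.
--
-- Consequently three consecutive windows W₁, W₂, W₃ of a sequence cannot all be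
-- distinct edges: the G-edge inside W₂ would equal both W₁ ∩ W₂ and W₂ ∩ W₃.
-- Hence every chain has at most two edges, and a semicycle with at most two edges
-- is ruled out directly because its first window repeats a vertex or is contained
-- in the second one.

open import Defs
open import Data.Nat using (ℕ; suc; _+_; _≤_; z≤n; s≤s; _≤?_)
open import Data.Nat.Properties
open import Data.Fin using (Fin)
open import Data.Fin.Properties using () renaming (_≟_ to _≟ᶠ_)
open import Data.Fin.Subset using (Subset; _∈_; _∉_; _⊆_; _∪_; _∩_; _─_; _-_; ⁅_⁆; ∣_∣; inside; outside)
open import Data.Fin.Subset.Properties
open import Data.Vec using (_∷_; here; there) renaming ([] to []ᵥ)
open import Data.List using (List; []; _∷_; _++_; [_]; take; length)
open import Data.List.Properties using (take-all; length-take)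
open import Data.List.Relation.Unary.All using (All; _∷_)
open import Data.List.Relation.Unary.AllPairs using (AllPairs; _∷_)
open import Data.Product using (∃; _×_; _,_; proj₁; proj₂)
open import Data.Sum using (_⊎_; inj₁; inj₂)
open import Data.Empty using (⊥; ⊥-elim)
open import Relation.Nullary using (¬_; yes; no)
open import Relation.Nullary.Decidable using (decidable-stable)
open import Relation.Binary.PropositionalEquality using (_≡_; _≢_; refl; sym; trans; cong; subst; module ≡-Reasoning)

private
  variable
    n : ℕ
    p q : Subset n
    x y : Fin n

∈─⇒∉ : ∀ (p q : Subset n) → x ∈ p ─ q → x ∉ q
∈─⇒∉ (_ ∷ p) (outside ∷ q) here      ()
∈─⇒∉ (_ ∷ p) (inside  ∷ q) ()        here
∈─⇒∉ (_ ∷ p) (outside ∷ q) (there h) (there h') = ∈─⇒∉ p q h h'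
∈─⇒∉ (_ ∷ p) (inside  ∷ q) (there h) (there h') = ∈─⇒∉ p q h h'

⊆-or-witness : ∀ (p q : Subset n) → p ⊆ q ⊎ ∃ λ x → x ∈ p × x ∉ q
⊆-or-witness p q with nonempty? (p ─ q)
... | yes (x , x∈p─q) = inj₂ (x , p─q⊆p p q x∈p─q , ∈─⇒∉ p q x∈p─q)
... | no  p─q-empty   = inj₁ λ {x} x∈p →
  decidable-stable (x ∈? q) (λ x∉q → p─q-empty (x , x∈p∧x∉q⇒x∈p─q x∈p x∉q))

x∈p∪⁅x⁆ : x ∈ p ∪ ⁅ x ⁆
x∈p∪⁅x⁆ {x = x} = x∈p∪q⁺ (inj₂ (x∈⁅x⁆ x))

∈-∪⁅⁆⁻ : y ∈ p ∪ ⁅ x ⁆ → y ∈ p ⊎ y ≡ x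
∈-∪⁅⁆⁻ {p = p} {x = x} y∈ with x∈p∪q⁻ p ⁅ x ⁆ y∈
... | inj₁ y∈p = inj₁ y∈p
... | inj₂ y∈x = inj₂ (x∈⁅y⁆⇒x≡y x y∈x)

∈-∪⁅⁆-≢ : y ∈ p ∪ ⁅ x ⁆ → y ≢ x → y ∈ p
∈-∪⁅⁆-≢ y∈ y≢x with ∈-∪⁅⁆⁻ y∈
... | inj₁ y∈p = y∈p
... | inj₂ y≡x = ⊥-elim (y≢x y≡x)

∈-remove⁻ : y ∈ p - x → y ∈ p × y ≢ x
∈-remove⁻ {p = p} {x = x} y∈ =
  p─q⊆p p ⁅ x ⁆ y∈ , λ { refl → ∈─⇒∉ p ⁅ x ⁆ y∈ (x∈⁅x⁆ x) }

∣p∪q∣≤∣p∣+∣q∣ : ∀ (p q : Subset n) → ∣ p ∪ q ∣ ≤ ∣ p ∣ + ∣ q ∣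
∣p∪q∣≤∣p∣+∣q∣ []ᵥ           []ᵥ           = z≤n
∣p∪q∣≤∣p∣+∣q∣ (outside ∷ p) (outside ∷ q) = ∣p∪q∣≤∣p∣+∣q∣ p q
∣p∪q∣≤∣p∣+∣q∣ (outside ∷ p) (inside  ∷ q) =
  ≤-trans (s≤s (∣p∪q∣≤∣p∣+∣q∣ p q)) (≤-reflexive (sym (+-suc ∣ p ∣ ∣ q ∣)))
∣p∪q∣≤∣p∣+∣q∣ (inside  ∷ p) (s       ∷ q) =
  s≤s (≤-trans (∣p∪q∣≤∣p∣+∣q∣ p q) (+-monoʳ-≤ ∣ p ∣ (∣p∣≤∣x∷p∣ s q)))

∣⁅x⁆∪p∣≤1+∣p∣ : ∀ (x : Fin n) p → ∣ ⁅ x ⁆ ∪ p ∣ ≤ suc ∣ p ∣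
∣⁅x⁆∪p∣≤1+∣p∣ x p = ≤-trans (∣p∪q∣≤∣p∣+∣q∣ ⁅ x ⁆ p) (≤-reflexive (cong (_+ ∣ p ∣) (∣⁅x⁆∣≡1 x)))

∣p∪⁅x⁆∣≡1+∣p∣ : x ∉ p → ∣ p ∪ ⁅ x ⁆ ∣ ≡ suc ∣ p ∣
∣p∪⁅x⁆∣≡1+∣p∣ {x = x} {p = p} x∉p = ≤-antisym
  (subst (_≤ suc ∣ p ∣) (cong ∣_∣ (∪-comm ⁅ x ⁆ p)) (∣⁅x⁆∪p∣≤1+∣p∣ x p))
  (p⊂q⇒∣p∣<∣q∣ (p⊆p∪q ⁅ x ⁆ , x , x∈p∪⁅x⁆ , x∉p))

⊆∧∣∣≥⇒≡ : p ⊆ q → ∣ q ∣ ≤ ∣ p ∣ → p ≡ q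
⊆∧∣∣≥⇒≡ {p = p} {q = q} p⊆q ∣q∣≤∣p∣ with ⊆-or-witness q p
... | inj₁ q⊆p = ⊆-antisym p⊆q q⊆p
... | inj₂ (x , x∈q , x∉p) = ⊥-elim (<⇒≱ (p⊂q⇒∣p∣<∣q∣ (p⊆q , x , x∈q , x∉p)) ∣q∣≤∣p∣)

one-point-extension : p ⊆ q → ∣ q ∣ ≡ suc ∣ p ∣ → ∃ λ x → x ∉ p × q ≡ p ∪ ⁅ x ⁆
one-point-extension {p = p} {q = q} p⊆q ∣q∣ with ⊆-or-witness q p
... | inj₁ q⊆p = ⊥-elim (1+n≰n (subst (_≤ ∣ p ∣) ∣q∣ (p⊆q⇒∣p∣≤∣q∣ q⊆p)))
... | inj₂ (x , x∈q , x∉p) =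
  x , x∉p , sym (⊆∧∣∣≥⇒≡ p∪⁅x⁆⊆q (≤-reflexive (trans ∣q∣ (sym (∣p∪⁅x⁆∣≡1+∣p∣ x∉p)))))
  where
  p∪⁅x⁆⊆q : p ∪ ⁅ x ⁆ ⊆ q
  p∪⁅x⁆⊆q y∈ with ∈-∪⁅⁆⁻ y∈
  ... | inj₁ y∈p = p⊆q y∈p
  ... | inj₂ refl = x∈q

∣p-x∣ : x ∈ p → suc ∣ p - x ∣ ≡ ∣ p ∣
∣p-x∣ {x = x} {p = p} x∈p = begin
  suc ∣ p - x ∣       ≡⟨ sym (∣p∪⁅x⁆∣≡1+∣p∣ {p = p - x} (λ x∈p-x → proj₂ (∈-remove⁻ x∈p-x) refl)) ⟩
  ∣ (p - x) ∪ ⁅ x ⁆ ∣ ≡⟨ cong ∣_∣ (⊆-antisym ⊆p p⊆) ⟩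
  ∣ p ∣               ∎
  where
  open ≡-Reasoning
  ⊆p : (p - x) ∪ ⁅ x ⁆ ⊆ p
  ⊆p y∈ with ∈-∪⁅⁆⁻ y∈
  ... | inj₁ y∈p-x = proj₁ (∈-remove⁻ y∈p-x)
  ... | inj₂ refl = x∈p
  p⊆ : p ⊆ (p - x) ∪ ⁅ x ⁆
  p⊆ {y} y∈p with y ≟ᶠ x
  ... | yes refl = x∈p∪⁅x⁆
  ... | no  y≢x  = p⊆p∪q ⁅ x ⁆ (x∈p∧x≢y⇒x∈p-y y∈p y≢x)

∣listSet∣≤length : ∀ (xs : List (Fin n)) → ∣ listSet xs ∣ ≤ length xs
∣listSet∣≤length {n} []       = ≤-reflexive (∣⊥∣≡0 n)
∣listSet∣≤length (x ∷ xs) = ≤-trans (∣⁅x⁆∪p∣≤1+∣p∣ x (listSet xs)) (s≤s (∣listSet∣≤length xs))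

cons-distinct : ∀ (x : Fin n) xs {m} → ∣ listSet (x ∷ xs) ∣ ≡ suc m → length xs ≤ m →
                x ∉ listSet xs × ∣ listSet xs ∣ ≡ m
cons-distinct x xs {m} ∣x∷xs∣ length≤m = x∉xs , ≤-antisym ∣xs∣≤m m≤∣xs∣
  where
  ∣xs∣≤m : ∣ listSet xs ∣ ≤ m
  ∣xs∣≤m = ≤-trans (∣listSet∣≤length xs) length≤m
  m≤∣xs∣ : m ≤ ∣ listSet xs ∣
  m≤∣xs∣ = ≤-pred (subst (_≤ suc ∣ listSet xs ∣) ∣x∷xs∣ (∣⁅x⁆∪p∣≤1+∣p∣ x (listSet xs)))
  x∉xs : x ∉ listSet xs
  x∉xs x∈xs = 1+n≰n (≤-trans (≤-reflexive (sym ∣x∷xs∣)) (≤-trans (p⊆q⇒∣p∣≤∣q∣ x∷xs⊆xs) ∣xs∣≤m))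
    where
    x∷xs⊆xs : listSet (x ∷ xs) ⊆ listSet xs
    x∷xs⊆xs y∈ with x∈p∪q⁻ ⁅ x ⁆ (listSet xs) y∈
    ... | inj₁ y∈x  = subst (_∈ listSet xs) (sym (x∈⁅y⁆⇒x≡y x y∈x)) x∈xs
    ... | inj₂ y∈xs = y∈xs

listSet-take-mono : ∀ {m m′} → m ≤ m′ → (xs : List (Fin n)) → listSet (take m xs) ⊆ listSet (take m′ xs)
listSet-take-mono z≤n       xs       y∈ = ⊥-elim (∉⊥ y∈)
listSet-take-mono (s≤s m≤m′) []       y∈ = y∈
listSet-take-mono (s≤s m≤m′) (x ∷ xs) y∈ with x∈p∪q⁻ ⁅ x ⁆ _ y∈
... | inj₁ y∈x   = x∈p∪q⁺ (inj₁ y∈x)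
... | inj₂ y∈xs  = x∈p∪q⁺ (inj₂ (listSet-take-mono m≤m′ xs y∈xs))

length-take≤ : ∀ {A : Set} m (xs : List A) → length (take m xs) ≤ m
length-take≤ m xs = ≤-trans (≤-reflexive (length-take m xs)) (m⊓n≤m m (length xs))

last∈listSet : ∀ (x : Fin n) ys → x ∈ listSet (ys ++ [ x ])
last∈listSet x []       = x∈p∪q⁺ (inj₁ (x∈⁅x⁆ x))
last∈listSet x (y ∷ ys) = x∈p∪q⁺ (inj₂ (last∈listSet x ys))

windows-short : ∀ {A : Set} k (xs : List A) → ¬ (k ≤ length xs) → windows k xs ≡ []
windows-short k []       _  = refl
windows-short k (x ∷ xs) k≰ with k ≤? length (x ∷ xs)
... | yes k≤ = ⊥-elim (k≰ k≤)
... | no  _  = refl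

windowSets-cons : ∀ k (x : Fin n) xs → k ≤ length (x ∷ xs) →
                  windowSets k (x ∷ xs) ≡ listSet (take k (x ∷ xs)) ∷ windowSets k xs
windowSets-cons k x xs k≤ with k ≤? length (x ∷ xs)
... | yes _ = refl
... | no k≰ = ⊥-elim (k≰ k≤)

first-windows-distinct : ∀ k (x : Fin n) xs → suc k ≤ length xs → AllPairs _≢_ (windowSets (suc k) (x ∷ xs)) →
                         listSet (take (suc k) (x ∷ xs)) ≢ listSet (take (suc k) xs)
first-windows-distinct k x (y ∷ ys) k< distinct
  rewrite windowSets-cons (suc k) x (y ∷ ys) (m≤n⇒m≤1+n k<) | windowSets-cons (suc k) y ys k<
  with distinct
... | (W₁≢W₂ ∷ _) ∷ _ = W₁≢W₂

length-windows-cons : ∀ {A : Set} k (x : A) xs → length (windows k (x ∷ xs)) ≤ suc (length (windows k xs))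
length-windows-cons k x xs with k ≤? length (x ∷ xs)
... | yes _ = ≤-refl
... | no  _ = z≤n

length-windows≤length : ∀ {A : Set} k (xs : List A) → length (windows k xs) ≤ length xs
length-windows≤length k []       = z≤n
length-windows≤length k (x ∷ xs) = ≤-trans (length-windows-cons k x xs) (s≤s (length-windows≤length k xs))

windows-count : ∀ {A : Set} k (xs : List A) → 1 ≤ k → suc (length xs) ≤ length (windows k xs) + k
windows-count k []       1≤k = 1≤k
windows-count k (x ∷ xs) 1≤k with k ≤? length (x ∷ xs)
... | yes _ = s≤s (windows-count k xs 1≤k)
... | no k≰ = ≰⇒> k≰

module SteinerExtension
  (j : ℕ) (F E : Hypergraph n)
  (F-uniform : Uniform (2 + j) F)
  (F-packing : ∀ S → ∣ S ∣ ≡ 1 + j → ∀ f g → F f → F g → S ⊆ f → S ⊆ g → f ≡ g)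
  (extension : IsExtension E F)
  (no-mutual : NoMutuallyExtended (3 + j) E F)
  where

  module TwoEdges {P : Subset n} {a b : Fin n} (a∉P : a ∉ P) (b∉P : b ∉ P) (a≢b : a ≢ b)
                  (∣P∣ : ∣ P ∣ ≡ 2 + j) (E₁ : E (P ∪ ⁅ a ⁆)) (E₂ : E (P ∪ ⁅ b ⁆)) where

    ∣P∪⁅x⁆∣ : x ∉ P → ∣ P ∪ ⁅ x ⁆ ∣ ≡ 3 + j
    ∣P∪⁅x⁆∣ x∉P = trans (∣p∪⁅x⁆∣≡1+∣p∣ x∉P) (cong suc ∣P∣)

    common⊆P : y ∈ P ∪ ⁅ a ⁆ → y ∈ P ∪ ⁅ b ⁆ → y ∈ P
    common⊆P y∈e₁ y∈e₂ with ∈-∪⁅⁆⁻ y∈e₁ | ∈-∪⁅⁆⁻ y∈e₂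
    ... | inj₁ y∈P  | _         = y∈P
    ... | inj₂ _    | inj₁ y∈P  = y∈P
    ... | inj₂ refl | inj₂ refl = ⊥-elim (a≢b refl)

    module Faces {f f₁ : Subset n} {x₁ x₂ : Fin n} (Ff : F f) (Ff₁ : F f₁) (b∈f : b ∈ f)
                 (x₂∉f : x₂ ∉ f) (e₂≡ : P ∪ ⁅ b ⁆ ≡ f ∪ ⁅ x₂ ⁆)
                 (x₁∉f₁ : x₁ ∉ f₁) (e₁≡ : P ∪ ⁅ a ⁆ ≡ f₁ ∪ ⁅ x₁ ⁆) where

      P→f : y ∈ P → y ≢ x₂ → y ∈ f
      P→f y∈P = ∈-∪⁅⁆-≢ (subst (_ ∈_) e₂≡ (p⊆p∪q ⁅ b ⁆ y∈P))

      P→f₁ : y ∈ P → y ≢ x₁ → y ∈ f₁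
      P→f₁ y∈P = ∈-∪⁅⁆-≢ (subst (_ ∈_) e₁≡ (p⊆p∪q ⁅ a ⁆ y∈P))

      f⊆e₂ : f ⊆ P ∪ ⁅ b ⁆
      f⊆e₂ y∈f = subst (_ ∈_) (sym e₂≡) (p⊆p∪q ⁅ x₂ ⁆ y∈f)

      f₁⊆e₁ : f₁ ⊆ P ∪ ⁅ a ⁆
      f₁⊆e₁ y∈f₁ = subst (_ ∈_) (sym e₁≡) (p⊆p∪q ⁅ x₁ ⁆ y∈f₁)

      x₂∈P : x₂ ∈ P
      x₂∈P = ∈-∪⁅⁆-≢ (subst (_ ∈_) (sym e₂≡) x∈p∪⁅x⁆) λ { refl → x₂∉f b∈f }

      f₁∩f⊆P : y ∈ f₁ → y ∈ f → y ∈ P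
      f₁∩f⊆P y∈f₁ y∈f = common⊆P (f₁⊆e₁ y∈f₁) (f⊆e₂ y∈f)

      -- If f₁ contains the (k-2)-set P - x₂ ⊆ f, then f₁ = f, so b ∈ f₁ ∩ f ⊆ P.
      shared-ridge : x₁ ∉ P - x₂ → ⊥
      shared-ridge x₁∉ = b∉P (f₁∩f⊆P (subst (b ∈_) (sym f₁≡f) b∈f) b∈f)
        where
        ridge⊆f₁ : P - x₂ ⊆ f₁
        ridge⊆f₁ y∈ with ∈-remove⁻ y∈
        ... | y∈P , _ = P→f₁ y∈P λ { refl → x₁∉ y∈ }
        ridge⊆f : P - x₂ ⊆ f
        ridge⊆f y∈ with ∈-remove⁻ y∈
        ... | y∈P , y≢x₂ = P→f y∈P y≢x₂
        f₁≡f : f₁ ≡ f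
        f₁≡f = F-packing (P - x₂) (suc-injective (trans (∣p-x∣ x₂∈P) ∣P∣)) f₁ f Ff₁ Ff ridge⊆f₁ ridge⊆f

      -- Otherwise f₁ ∩ f = P - x₂ - x₁, and f₁ ∪ {x₁}, f ∪ {x₂} are edges of E.
      mutually-extended : x₁ ∈ P - x₂ → MutuallyExtended (3 + j) E f₁ f
      mutually-extended x₁∈ = ∣f₁∩f∣ , x₂ , x₁ , x₂∈f₁ , x₁∈f
                            , subst E e₁≡ E₁ , subst E e₂≡ E₂
        where
        x₁∈P : x₁ ∈ P
        x₁∈P = proj₁ (∈-remove⁻ x₁∈)
        x₁≢x₂ : x₁ ≢ x₂
        x₁≢x₂ = proj₂ (∈-remove⁻ x₁∈)
        x₁∈f : x₁ ∈ f
        x₁∈f = P→f x₁∈P x₁≢x₂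
        x₂∈f₁ : x₂ ∈ f₁
        x₂∈f₁ = P→f₁ x₂∈P λ x₂≡x₁ → x₁≢x₂ (sym x₂≡x₁)
        ∩⊆ : f₁ ∩ f ⊆ P - x₂ - x₁
        ∩⊆ y∈ with x∈p∩q⁻ f₁ f y∈
        ... | y∈f₁ , y∈f = x∈p∧x≢y⇒x∈p-y (x∈p∧x≢y⇒x∈p-y (f₁∩f⊆P y∈f₁ y∈f)
                             λ { refl → x₂∉f y∈f }) λ { refl → x₁∉f₁ y∈f₁ }
        ⊆∩ : P - x₂ - x₁ ⊆ f₁ ∩ f
        ⊆∩ y∈ with ∈-remove⁻ y∈
        ... | y∈P-x₂ , y≢x₁ with ∈-remove⁻ y∈P-x₂
        ...   | y∈P , y≢x₂ = x∈p∩q⁺ (P→f₁ y∈P y≢x₁ , P→f y∈P y≢x₂)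
        ∣f₁∩f∣ : ∣ f₁ ∩ f ∣ ≡ j
        ∣f₁∩f∣ = trans (cong ∣_∣ (⊆-antisym ∩⊆ ⊆∩))
                   (suc-injective (suc-injective (trans (cong suc (∣p-x∣ x₁∈))
                                                        (trans (∣p-x∣ x₂∈P) ∣P∣))))

      impossible : ⊥
      impossible with x₁ ∈? (P - x₂)
      ... | no  x₁∉ = shared-ridge x₁∉
      ... | yes x₁∈ = no-mutual f₁ f Ff₁ Ff (mutually-extended x₁∈)

    face⊆P : ∀ f → F f → f ⊆ P ∪ ⁅ b ⁆ → f ⊆ P
    face⊆P f Ff f⊆e₂ with ⊆-or-witness f P
    ... | inj₁ f⊆P = f⊆P
    ... | inj₂ (y , y∈f , y∉P)
      with one-point-extension f⊆e₂ (trans (∣P∪⁅x⁆∣ b∉P) (cong suc (sym (F-uniform f Ff))))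
         | extension (P ∪ ⁅ a ⁆) E₁
    ... | x₂ , x₂∉f , e₂≡ | f₁ , Ff₁ , f₁⊆e₁
      with one-point-extension f₁⊆e₁ (trans (∣P∪⁅x⁆∣ a∉P) (cong suc (sym (F-uniform f₁ Ff₁))))
    ... | x₁ , x₁∉f₁ , e₁≡ = ⊥-elim (Faces.impossible Ff Ff₁ b∈f x₂∉f e₂≡ x₁∉f₁ e₁≡)
      where
      b∈f : b ∈ f
      b∈f with ∈-∪⁅⁆⁻ (f⊆e₂ y∈f)
      ... | inj₁ y∈P  = ⊥-elim (y∉P y∈P)
      ... | inj₂ refl = y∈f

  shared-face : ∀ {e₁ e₂ P : Subset n} → E e₁ → E e₂ → ∣ e₁ ∣ ≡ 3 + j → ∣ e₂ ∣ ≡ 3 + j →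
                e₁ ≢ e₂ → P ⊆ e₁ → P ⊆ e₂ → ∣ P ∣ ≡ 2 + j → ∀ f → F f → f ⊆ e₂ → f ≡ P
  shared-face {P = P} E₁ E₂ ∣e₁∣ ∣e₂∣ e₁≢e₂ P⊆e₁ P⊆e₂ ∣P∣ f Ff f⊆e₂
    with one-point-extension P⊆e₁ (trans ∣e₁∣ (cong suc (sym ∣P∣)))
       | one-point-extension P⊆e₂ (trans ∣e₂∣ (cong suc (sym ∣P∣)))
  ... | a , a∉P , refl | b , b∉P , refl =
    ⊆∧∣∣≥⇒≡ f⊆P (≤-reflexive (trans ∣P∣ (sym (F-uniform f Ff))))
    where
    f⊆P : f ⊆ P
    f⊆P = TwoEdges.face⊆P a∉P b∉P (λ { refl → e₁≢e₂ refl }) ∣P∣ E₁ E₂ f Ff f⊆e₂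

  -- Three edges W₁ ≠ W₂ ≠ W₃ of E with (k-1)-sets P ⊆ W₁ ∩ W₂ and Q ⊆ W₂ ∩ W₃
  -- force P = Q: both equal the F-edge inside W₂.
  middle-face : ∀ {W₁ W₂ W₃ P Q : Subset n} → E W₁ → E W₂ → E W₃ →
                ∣ W₁ ∣ ≡ 3 + j → ∣ W₂ ∣ ≡ 3 + j → ∣ W₃ ∣ ≡ 3 + j → W₁ ≢ W₂ → W₂ ≢ W₃ →
                P ⊆ W₁ → P ⊆ W₂ → Q ⊆ W₂ → Q ⊆ W₃ → ∣ P ∣ ≡ 2 + j → ∣ Q ∣ ≡ 2 + j → P ≡ Q
  middle-face {W₂ = W₂} E₁ E₂ E₃ ∣W₁∣ ∣W₂∣ ∣W₃∣ W₁≢W₂ W₂≢W₃ P⊆W₁ P⊆W₂ Q⊆W₂ Q⊆W₃ ∣P∣ ∣Q∣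
    with extension W₂ E₂
  ... | f , Ff , f⊆W₂ =
    trans (sym (shared-face E₁ E₂ ∣W₁∣ ∣W₂∣ W₁≢W₂ P⊆W₁ P⊆W₂ ∣P∣ f Ff f⊆W₂))
          (shared-face E₃ E₂ ∣W₃∣ ∣W₂∣ (λ W₃≡W₂ → W₂≢W₃ (sym W₃≡W₂)) Q⊆W₃ Q⊆W₂ ∣Q∣ f Ff f⊆W₂)

  GoodWindow : Subset n → Set
  GoodWindow w = (∣ w ∣ ≡ 3 + j) × E w

  -- Three consecutive windows W₁ = {x₁} ∪ P, W₂ = {x₂} ∪ Q ⊇ P and W₃ ⊇ Q cannot be
  -- distinct edges of E: middle-face would give P = Q, but x₂ ∈ P and x₂ ∉ Q.
  consecutive-windows : ∀ (x₁ x₂ : Fin n) u →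
    GoodWindow (listSet (take (3 + j) (x₁ ∷ x₂ ∷ u))) →
    GoodWindow (listSet (take (3 + j) (x₂ ∷ u))) →
    GoodWindow (listSet (take (3 + j) u)) →
    listSet (take (3 + j) (x₁ ∷ x₂ ∷ u)) ≢ listSet (take (3 + j) (x₂ ∷ u)) →
    listSet (take (3 + j) (x₂ ∷ u)) ≢ listSet (take (3 + j) u) → ⊥
  consecutive-windows x₁ x₂ u (∣W₁∣ , E₁) (∣W₂∣ , E₂) (∣W₃∣ , E₃) W₁≢W₂ W₂≢W₃ =
    x₂∉Q (subst (x₂ ∈_) P≡Q (x∈p∪q⁺ (inj₁ (x∈⁅x⁆ x₂))))
    where
    P Q : Subset n
    P = listSet (take (2 + j) (x₂ ∷ u))
    Q = listSet (take (2 + j) u)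
    x₁∉P×∣P∣ : x₁ ∉ P × ∣ P ∣ ≡ 2 + j
    x₁∉P×∣P∣ = cons-distinct x₁ (take (2 + j) (x₂ ∷ u)) ∣W₁∣ (length-take≤ (2 + j) (x₂ ∷ u))
    x₂∉Q×∣Q∣ : x₂ ∉ Q × ∣ Q ∣ ≡ 2 + j
    x₂∉Q×∣Q∣ = cons-distinct x₂ (take (2 + j) u) ∣W₂∣ (length-take≤ (2 + j) u)
    x₂∉Q : x₂ ∉ Q
    x₂∉Q = proj₁ x₂∉Q×∣Q∣
    P≡Q : P ≡ Q
    P≡Q = middle-face E₁ E₂ E₃ ∣W₁∣ ∣W₂∣ ∣W₃∣ W₁≢W₂ W₂≢W₃
            (q⊆p∪q ⁅ x₁ ⁆ P) (listSet-take-mono (n≤1+n (2 + j)) (x₂ ∷ u))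
            (q⊆p∪q ⁅ x₂ ⁆ Q) (listSet-take-mono (n≤1+n (2 + j)) u)
            (proj₂ x₁∉P×∣P∣) (proj₂ x₂∉Q×∣Q∣)

  at-most-two-windows : ∀ xs → SeqSub (3 + j) E xs → length (windows (3 + j) xs) ≤ 2
  at-most-two-windows []            _ = z≤n
  at-most-two-windows (x ∷ [])      _ = ≤-trans (length-windows≤length (3 + j) (x ∷ [])) (n≤1+n 1)
  at-most-two-windows (x ∷ y ∷ [])  _ = length-windows≤length (3 + j) (x ∷ y ∷ [])
  at-most-two-windows (x₁ ∷ x₂ ∷ x₃ ∷ r) (_ , good , distinct) with 3 + j ≤? length (x₃ ∷ r)
  ... | no k≰ =
    ≤-trans (length-windows-cons (3 + j) x₁ (x₂ ∷ x₃ ∷ r))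
      (s≤s (≤-trans (length-windows-cons (3 + j) x₂ (x₃ ∷ r))
        (s≤s (≤-reflexive (cong length (windows-short (3 + j) (x₃ ∷ r) k≰))))))
  ... | yes k≤ = ⊥-elim (three-windows good distinct)
    where
    three-windows : All GoodWindow (windowSets (3 + j) (x₁ ∷ x₂ ∷ x₃ ∷ r)) →
                    AllPairs _≢_ (windowSets (3 + j) (x₁ ∷ x₂ ∷ x₃ ∷ r)) → ⊥
    three-windows
      rewrite windowSets-cons (3 + j) x₁ (x₂ ∷ x₃ ∷ r) (m≤n⇒m≤1+n (m≤n⇒m≤1+n k≤))
            | windowSets-cons (3 + j) x₂ (x₃ ∷ r) (m≤n⇒m≤1+n k≤)
            | windowSets-cons (3 + j) x₃ r k≤
      = λ { (G₁ ∷ G₂ ∷ G₃ ∷ _) ((W₁≢W₂ ∷ _) ∷ (W₂≢W₃ ∷ _) ∷ _) →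
              consecutive-windows x₁ x₂ (x₃ ∷ r) G₁ G₂ G₃ W₁≢W₂ W₂≢W₃ }

  -- A semicycle a ∷ ys with ys = mid ++ [a] has at most two windows, so ys has at most
  -- k vertices and is its own last window.  Its first window W₁ = {a} ∪ (prefix of ys)
  -- then lies inside the vertex set of ys: impossible if ys is shorter than k, and
  -- forcing W₁ to equal the second window otherwise.
  module Semicycle (a : Fin n) (mid : List (Fin n)) (seq : SeqSub (3 + j) E (a ∷ mid ++ [ a ])) where

    ys : List (Fin n)
    ys = mid ++ [ a ]

    W₁ : Subset n
    W₁ = listSet (take (3 + j) (a ∷ ys))

    ∣W₁∣ : ∣ W₁ ∣ ≡ 3 + j
    ∣W₁∣ = first-window (proj₁ (proj₂ seq))
      where
      first-window : All GoodWindow (windowSets (3 + j) (a ∷ ys)) → ∣ W₁ ∣ ≡ 3 + j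
      first-window rewrite windowSets-cons (3 + j) a ys (proj₁ seq) = λ { ((∣W∣ , _) ∷ _) → ∣W∣ }

    ys-short : length ys ≤ 3 + j
    ys-short = ≤-pred (≤-pred (≤-trans (windows-count (3 + j) (a ∷ ys) (s≤s z≤n))
                                       (+-monoˡ-≤ (3 + j) (at-most-two-windows (a ∷ ys) seq))))

    ys-whole : take (3 + j) ys ≡ ys
    ys-whole = take-all (3 + j) ys ys-short

    W₁⊆ys : W₁ ⊆ listSet ys
    W₁⊆ys y∈ with x∈p∪q⁻ ⁅ a ⁆ _ y∈
    ... | inj₁ y∈a    = subst (_∈ listSet ys) (sym (x∈⁅y⁆⇒x≡y a y∈a)) (last∈listSet a mid)
    ... | inj₂ y∈pref = subst (λ zs → _ ∈ listSet zs) ys-whole (listSet-take-mono (n≤1+n (2 + j)) ys y∈pref)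

    ∣W₁∣≤∣ys∣ : ∣ W₁ ∣ ≤ length ys
    ∣W₁∣≤∣ys∣ = ≤-trans (p⊆q⇒∣p∣≤∣q∣ W₁⊆ys) (∣listSet∣≤length ys)

    impossible : ⊥
    impossible with 3 + j ≤? length ys
    ... | no  k≰ys = k≰ys (subst (_≤ length ys) ∣W₁∣ ∣W₁∣≤∣ys∣)
    ... | yes k≤ys = first-windows-distinct (2 + j) a ys k≤ys (proj₂ (proj₂ seq))
                       (trans (⊆∧∣∣≥⇒≡ W₁⊆ys ∣ys∣≤∣W₁∣) (cong listSet (sym ys-whole)))
      where
      ∣ys∣≤∣W₁∣ : ∣ listSet ys ∣ ≤ ∣ W₁ ∣
      ∣ys∣≤∣W₁∣ = ≤-trans (∣listSet∣≤length ys) (≤-trans ys-short (≤-reflexive (sym ∣W₁∣)))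

  no-semicycle : SemicycleFree (3 + j) E
  no-semicycle .(a ∷ mid ++ [ a ]) (seq , a , mid , refl) = Semicycle.impossible a mid seq

lemma5 : (k n : ℕ) → 3 ≤ k → (F E : Hypergraph n) →
         IsSteiner k F → Uniform k E → IsExtension E F →
         ChainConnected k E → NoMutuallyExtended k E F →
         Is2Hypertree k E
lemma5 k n (s≤s (s≤s (s≤s {n = j} _))) F E (F-uniform , steiner) E-uniform extension connected no-mutual =
  (E-uniform , connected , no-semicycle) , λ xs chain → at-most-two-windows xs (proj₁ chain)
  where
  open SteinerExtension j F E F-uniform (λ S ∣S∣ → proj₂ (steiner S ∣S∣)) extension no-mutual
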